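{- For every integer $k\geq 1$, the binary string $F_k=00(10)^k111$ is $3$-prime.
   Context: $(10)^k$ denotes $k$ concatenated copies of the word $10$. For a finite binary string $s$ (indexed from $0$), $n(s)=\{i: s_i=1\}$; for a binary string $S$, $\mathfrak{S}=\{n(s): s \text{ a finite contiguous substring of } S\}$; a set $B\subseteq\mathbb{N}$ is shattered if $\{c\cap B: c\in\mathfrak{S}\}$ is the power set of $B$; $VCdim(S)$ is the largest size of a shattered set. A binary string $S$ is $d$-prime if $VCdim(S)=d$ and every proper contiguous substring $S'$ of $S$ has $VCdim(S')<d$. -}

module Defs where

open import Data.Bool using (Bool; true; false)
open import Data.Nat using (ℕ; zero; suc; _≤_; _<_)
open import Data.List using (List; []; _∷_; _++_; length; concat; replicate)
open import Data.List.Membership.Propositional using (_∈_)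
open import Data.List.Relation.Unary.Unique.Propositional using (Unique)
open import Data.List.Relation.Binary.Sublist.Propositional using (_⊆_)
open import Data.Product using (Σ; ∃; _×_)
open import Data.Unit using (⊤)
open import Data.Empty using (⊥)
open import Function.Bundles using (_⇔_)
open import Relation.Binary.PropositionalEquality using (_≡_)

-- Binary strings: lists of booleans (true = 1, false = 0), indexed from 0.
BinStr : Set
BinStr = List Bool

-- IsOne s i  :⇔  i ∈ n(s), i.e. s_i = 1 (positions outside s are not in n(s)).
IsOne : BinStr → ℕ → Set
IsOne []          _       = ⊥
IsOne (true ∷ _)  zero    = ⊤
IsOne (false ∷ _) zero    = ⊥
IsOne (_ ∷ s)     (suc i) = IsOne s i

Substring : BinStr → BinStr → Set
Substring s S = Σ BinStr λ p → Σ BinStr λ q → S ≡ p ++ s ++ q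

-- A finite set B ⊆ ℕ, given as a duplicate-free list, is shattered by 𝔖(S):
-- every subset T of B (a sublist of B) equals c ∩ B for some c = n(s),
-- s a contiguous substring of S.
Shattered : BinStr → List ℕ → Set
Shattered S B =
  Unique B ×
  (∀ (T : List ℕ) → T ⊆ B →
     Σ BinStr λ s → Substring s S × (∀ b → b ∈ B → (IsOne s b ⇔ b ∈ T)))

VCdim : BinStr → ℕ → Set
VCdim S d =
  (Σ (List ℕ) λ B → Shattered S B × length B ≡ d) ×
  (∀ B → Shattered S B → length B ≤ d)

Prime : ℕ → BinStr → Set
Prime d S =
  VCdim S d ×
  (∀ S' → Substring S' S → length S' < length S → ∀ d' → VCdim S' d' → d' < d)

F : ℕ → BinStr
F k = false ∷ false ∷ (concat (replicate k (true ∷ false ∷ [])) ++ true ∷ true ∷ true ∷ [])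

{-# OPTIONS --safe #-}
module Submission where

-- The ones of F k sit at the even positions 2, 4, …, m + 1 and at the single odd position
-- m = oddOne k = 2k + 3.  In a window containing a whole shattered set at most one point is
-- at an odd position, and three points of equal parity are never shattered: whenever the
-- outer two are ones at even positions, so is the middle one.  Hence no four points are
-- shattered.  In a shattered triple the point of the minority parity must therefore lie
-- strictly between the other two; then seeing all three needs a window reaching the last
-- position m + 1, and seeing only the largest needs a window starting at position 0, so no
-- proper substring shatters three points.  For k ≥ 1, F k itself shatters {0, 1, 2}.

open import Defs
open import Data.Bool using (true; false)
open import Data.Nat using (ℕ; zero; suc; _+_; _≤_; _<_; z≤n; s≤s; parity; _≟_)
open import Data.Nat.Properties
open import Data.Parity.Base using (Parity; 0ℙ; 1ℙ; _⁻¹) renaming (_+_ to _+ℙ_)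
open import Data.Parity.Properties using (+-homo-+) renaming (+-cancelˡ-≡ to +ℙ-cancelˡ-≡; _≟_ to _≟ℙ_)
open import Data.List using (List; []; _∷_; _++_; length; concat; replicate; filter)
open import Data.List.Properties using (length-++; ++-assoc; ++-identityʳ)
open import Data.List.Membership.Propositional using (_∈_)
open import Data.List.Membership.Propositional.Properties using (∈-filter⁺; ∈-filter⁻)
open import Data.List.Membership.DecPropositional _≟_ using (_∈?_)
open import Data.List.Relation.Unary.Any using (here; there)
open import Data.List.Relation.Unary.All using (All; []; _∷_; lookup)
open import Data.List.Relation.Unary.AllPairs using ([]; _∷_)
open import Data.List.Relation.Unary.Unique.Propositional using (Unique)
open import Data.List.Relation.Binary.Sublist.Propositional using (_⊆_; []; _∷_; _∷ʳ_)
open import Data.List.Relation.Binary.Sublist.Propositional.Properties using (filter-⊆)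
open import Data.Product using (Σ; _×_; _,_; proj₂)
open import Data.Sum using (_⊎_; inj₁; inj₂; [_,_]′)
open import Data.Unit using (⊤; tt)
open import Data.Empty using (⊥; ⊥-elim)
open import Function using (id; _∘_)
open import Function.Bundles using (_⇔_; mk⇔; Equivalence)
open import Relation.Nullary using (¬_; Dec; yes; no; does; ¬?; contradiction)
open import Relation.Unary using (Decidable)
open import Relation.Binary using (tri<; tri≈; tri>)
open import Relation.Binary.PropositionalEquality

IsOne-++ˡ : ∀ p s i → IsOne (p ++ s) (length p + i) ≡ IsOne s i
IsOne-++ˡ []          s i = refl
IsOne-++ˡ (true ∷ p)  = IsOne-++ˡ p
IsOne-++ˡ (false ∷ p) = IsOne-++ˡ p

IsOne⇒< : ∀ s i → IsOne s i → i < length s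
IsOne⇒< (true ∷ s)  zero    _ = s≤s z≤n
IsOne⇒< (true ∷ s)  (suc i) h = s≤s (IsOne⇒< s i h)
IsOne⇒< (false ∷ s) (suc i) h = s≤s (IsOne⇒< s i h)

IsOne-++ʳ : ∀ s q i → i < length s → IsOne (s ++ q) i ≡ IsOne s i
IsOne-++ʳ (true ∷ s)  q zero    _         = refl
IsOne-++ʳ (false ∷ s) q zero    _         = refl
IsOne-++ʳ (true ∷ s)  q (suc i) (s≤s i<s) = IsOne-++ʳ s q i i<s
IsOne-++ʳ (false ∷ s) q (suc i) (s≤s i<s) = IsOne-++ʳ s q i i<s

IsOne-infix : ∀ {S} p s q → S ≡ p ++ s ++ q → ∀ i →
              IsOne s i ⇔ (i < length s × IsOne S (length p + i))
IsOne-infix p s q refl i = mk⇔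
  (λ h → IsOne⇒< s i h , subst id (sym (shift (IsOne⇒< s i h))) h)
  (λ (i<s , h) → subst id (shift i<s) h)
  where
  shift : i < length s → IsOne (p ++ s ++ q) (length p + i) ≡ IsOne s i
  shift i<s = trans (IsOne-++ˡ p (s ++ q) i) (IsOne-++ʳ s q i i<s)

infix-trans : ∀ {S S' s : BinStr} u v p q → S ≡ u ++ S' ++ v → S' ≡ p ++ s ++ q →
              S ≡ (u ++ p) ++ s ++ (q ++ v)
infix-trans {s = s} u v p q refl refl = begin
  u ++ (p ++ s ++ q) ++ v   ≡⟨ cong (u ++_) (++-assoc p (s ++ q) v) ⟩
  u ++ p ++ (s ++ q) ++ v   ≡⟨ cong (λ w → u ++ p ++ w) (++-assoc s q v) ⟩
  u ++ p ++ s ++ q ++ v     ≡⟨ ++-assoc u p (s ++ q ++ v) ⟨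
  (u ++ p) ++ s ++ q ++ v   ∎
  where open ≡-Reasoning

infix-length : ∀ (p s q : BinStr) → length p + length s ≤ length (p ++ s ++ q)
infix-length p s q = begin
  length p + length s               ≤⟨ +-monoʳ-≤ (length p) (m≤m+n (length s) (length q)) ⟩
  length p + (length s + length q)  ≡⟨ cong (length p +_) (length-++ s) ⟨
  length p + length (s ++ q)        ≡⟨ length-++ p ⟨
  length (p ++ s ++ q)              ∎
  where open ≤-Reasoning

module Windows (S : BinStr) where

  record Window (lo hi : ℕ) : Set where
    constructor window
    field
      start width : ℕ
      lo≤start    : lo ≤ start
      end≤hi      : start + width ≤ hi

  -- A window is the occurrence of a substring s of S, and w ∋ x says x ∈ n(s).
  infix 4 _∋_
  _∋_ : ∀ {lo hi} → Window lo hi → ℕ → Set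
  window o L _ _ ∋ x = x < L × IsOne S (o + x)

  WindowsShatter : ℕ → ℕ → List ℕ → Set₁
  WindowsShatter lo hi B = ∀ {P : ℕ → Set} → Decidable P →
    Σ (Window lo hi) λ w → ∀ b → b ∈ B → (w ∋ b ⇔ P b)

  allInWindow : ∀ {lo hi B} → WindowsShatter lo hi B →
                Σ (Window lo hi) λ w → ∀ b → b ∈ B → w ∋ b
  allInWindow shatters with shatters {λ _ → ⊤} (λ _ → yes tt)
  ... | w , cut = w , λ b b∈B → Equivalence.from (cut b b∈B) tt

  Shattered⇒WindowsShatter : ∀ {u S' v B} → S ≡ u ++ S' ++ v → Shattered S' B →
                             WindowsShatter (length u) (length u + length S') B
  Shattered⇒WindowsShatter {u} {S'} {v} {B} S≡ (_ , shatter) {P} P?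
    with shatter (filter P? B) (filter-⊆ P? B)
  ... | s , (p , q , S'≡) , cut = window (length (u ++ p)) (length s) lo≤ end≤ , cut′
    where
    occurrence : ∀ i → IsOne s i ⇔ (i < length s × IsOne S (length (u ++ p) + i))
    occurrence = IsOne-infix (u ++ p) s (q ++ v) (infix-trans u v p q S≡ S'≡)

    lo≤ : length u ≤ length (u ++ p)
    lo≤ = subst (length u ≤_) (sym (length-++ u)) (m≤m+n _ _)

    end≤ : length (u ++ p) + length s ≤ length u + length S'
    end≤ = begin
      length (u ++ p) + length s        ≡⟨ cong (_+ length s) (length-++ u) ⟩
      length u + length p + length s    ≡⟨ +-assoc (length u) _ _ ⟩
      length u + (length p + length s)  ≤⟨ +-monoʳ-≤ (length u) (infix-length p s q) ⟩
      length u + length (p ++ s ++ q)   ≡⟨ cong (λ w → length u + length w) S'≡ ⟨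
      length u + length S'              ∎
      where open ≤-Reasoning

    cut′ : ∀ b → b ∈ B → (window (length (u ++ p)) (length s) lo≤ end≤ ∋ b ⇔ P b)
    cut′ b b∈B = mk⇔
      (λ inW → proj₂ (∈-filter⁻ P? {xs = B}
                        (Equivalence.to (cut b b∈B) (Equivalence.from (occurrence b) inW))))
      (λ Pb → Equivalence.to (occurrence b) (Equivalence.from (cut b b∈B) (∈-filter⁺ P? b∈B Pb)))

≢⇒≡⁻¹ : ∀ {p q : Parity} → p ≢ q → q ≡ p ⁻¹
≢⇒≡⁻¹ {0ℙ} {0ℙ} p≢q = contradiction refl p≢q
≢⇒≡⁻¹ {0ℙ} {1ℙ} _   = refl
≢⇒≡⁻¹ {1ℙ} {0ℙ} _   = refl
≢⇒≡⁻¹ {1ℙ} {1ℙ} p≢q = contradiction refl p≢q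

parity-+ˡ-cancel : ∀ o {x y} → parity (o + x) ≡ parity (o + y) → parity x ≡ parity y
parity-+ˡ-cancel o {x} {y} eq =
  +ℙ-cancelˡ-≡ (parity o) _ _ (trans (sym (+-homo-+ o x)) (trans eq (+-homo-+ o y)))

parity-+ˡ-≡ : ∀ o {x y q} → parity x ≡ parity y → parity (o + x) ≡ q → parity (o + y) ≡ q
parity-+ˡ-≡ o {x} {y} {q} x≡y ex = begin
  parity (o + y)           ≡⟨ +-homo-+ o y ⟩
  parity o +ℙ parity y     ≡⟨ cong (parity o +ℙ_) x≡y ⟨
  parity o +ℙ parity x     ≡⟨ +-homo-+ o x ⟨
  parity (o + x)           ≡⟨ ex ⟩
  q                        ∎
  where open ≡-Reasoning

parity-+ˡ-≢ : ∀ o {x y q} → parity x ≢ parity y → parity (o + x) ≡ q → parity (o + y) ≡ q ⁻¹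
parity-+ˡ-≢ o x≢y ex = trans (≢⇒≡⁻¹ (x≢y ∘ parity-+ˡ-cancel o)) (cong _⁻¹ ex)

even⇒2≤ : ∀ {i} → parity i ≡ 0ℙ → 1 ≤ i → 2 ≤ i
even⇒2≤ {suc (suc _)} _ _ = s≤s (s≤s z≤n)

Between : ℕ → ℕ → ℕ → Set
Between a b c = (a < b × b < c) ⊎ (c < b × b < a)

some-between : ∀ {a b c} → a ≢ b → a ≢ c → b ≢ c →
               Between b a c ⊎ Between a b c ⊎ Between a c b
some-between {a} {b} {c} a≢b a≢c b≢c with <-cmp a b | <-cmp b c | <-cmp a c
... | tri≈ _ a≡b _ | _            | _            = contradiction a≡b a≢b
... | _            | tri≈ _ b≡c _ | _            = contradiction b≡c b≢c
... | _            | _            | tri≈ _ a≡c _ = contradiction a≡c a≢c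
... | tri< a<b _ _ | tri< b<c _ _ | _            = inj₂ (inj₁ (inj₁ (a<b , b<c)))
... | tri> _ _ b<a | tri> _ _ c<b | _            = inj₂ (inj₁ (inj₂ (c<b , b<a)))
... | tri< a<b _ _ | tri> _ _ c<b | tri< a<c _ _ = inj₂ (inj₂ (inj₁ (a<c , c<b)))
... | tri< a<b _ _ | tri> _ _ c<b | tri> _ _ c<a = inj₁ (inj₂ (c<a , a<b))
... | tri> _ _ b<a | tri< b<c _ _ | tri< a<c _ _ = inj₁ (inj₁ (b<a , a<c))
... | tri> _ _ b<a | tri< b<c _ _ | tri> _ _ c<a = inj₂ (inj₂ (inj₂ (b<c , c<a)))

no-two-above : ∀ {i j l} → i < j → j < l → ¬ l ≤ suc i
no-two-above i<j j<l l≤1+i = <⇒≱ i<j (≤-pred (≤-trans j<l l≤1+i))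

pattern first  = here refl
pattern second = there (here refl)
pattern third  = there (there (here refl))
pattern fourth = there (there (there (here refl)))

tens : ℕ → BinStr
tens k = concat (replicate k (true ∷ false ∷ []))

oddOne : ℕ → ℕ
oddOne k = 3 + length (tens k)

tail-one⇒ : ∀ k j → IsOne (tens k ++ true ∷ true ∷ true ∷ []) j →
            (parity j ≡ 0ℙ × j ≤ 2 + length (tens k)) ⊎ j ≡ 1 + length (tens k)
tail-one⇒ zero    0                   _ = inj₁ (refl , z≤n)
tail-one⇒ zero    1                   _ = inj₂ refl
tail-one⇒ zero    2                   _ = inj₁ (refl , ≤-refl)
tail-one⇒ zero    (suc (suc (suc j))) ()
tail-one⇒ (suc k) 0                   _ = inj₁ (refl , z≤n)
tail-one⇒ (suc k) 1                   ()
tail-one⇒ (suc k) (suc (suc j))       h with tail-one⇒ k j h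
... | inj₁ (even , j≤) = inj₁ (even , s≤s (s≤s j≤))
... | inj₂ j≡          = inj₂ (cong (2 +_) j≡)

even⇒tail-one : ∀ k j → parity j ≡ 0ℙ → j ≤ 2 + length (tens k) →
                IsOne (tens k ++ true ∷ true ∷ true ∷ []) j
even⇒tail-one zero    0                   _ _ = tt
even⇒tail-one zero    2                   _ _ = tt
even⇒tail-one zero    (suc (suc (suc j))) _ (s≤s (s≤s ()))
even⇒tail-one (suc k) 0                   _ _ = tt
even⇒tail-one (suc k) (suc (suc j))       even (s≤s (s≤s j≤)) = even⇒tail-one k j even j≤

F-odd-one : ∀ k {i} → IsOne (F k) i → parity i ≡ 1ℙ → i ≡ oddOne k
F-odd-one k {suc (suc j)} h odd with tail-one⇒ k j h
... | inj₁ (even , _) = contradiction (trans (sym even) odd) λ ()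
... | inj₂ j≡         = cong (2 +_) j≡

F-one⇒≤ : ∀ k {i} → IsOne (F k) i → i ≤ suc (oddOne k)
F-one⇒≤ k {suc (suc j)} h with tail-one⇒ k j h
... | inj₁ (_ , j≤) = s≤s (s≤s j≤)
... | inj₂ j≡       = ≤-trans (≤-reflexive (cong (2 +_) j≡)) (n≤1+n _)

F-even-one : ∀ k {i} → parity i ≡ 0ℙ → 2 ≤ i → i ≤ suc (oddOne k) → IsOne (F k) i
F-even-one k {suc (suc j)} even _ (s≤s (s≤s j≤)) = even⇒tail-one k j even j≤

F-even-between : ∀ k {i j l} → IsOne (F k) i → IsOne (F k) j → i ≤ l → l ≤ j →
                 parity l ≡ 0ℙ → IsOne (F k) l
F-even-between k {suc (suc _)} hi hj i≤l l≤j even =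
  F-even-one k even (≤-trans (s≤s (s≤s z≤n)) i≤l) (≤-trans l≤j (F-one⇒≤ k hj))

length-F : ∀ k → length (F k) ≡ 2 + oddOne k
length-F k = cong (2 +_) (trans (length-++ (tens k)) (+-comm _ 3))

module _ (k : ℕ) where
  open Windows (F k)

  private
    m : ℕ
    m = oddOne k

  odd-positions-coincide : ∀ {o x y} → IsOne (F k) (o + x) → IsOne (F k) (o + y) →
                           parity (o + x) ≡ 1ℙ → parity (o + y) ≡ 1ℙ → x ≡ y
  odd-positions-coincide {o} {x} {y} hx hy ox oy =
    +-cancelˡ-≡ o x y (trans (F-odd-one k hx ox) (sym (F-odd-one k hy oy)))

  no-sameParity-between : ∀ {lo hi B a b c p} → WindowsShatter lo hi B →
    a ∈ B → b ∈ B → c ∈ B → parity a ≡ p → parity b ≡ p → parity c ≡ p →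
    a < b → b < c → ⊥
  no-sameParity-between {a = a} {b} {c} shatters a∈ b∈ c∈ pa pb pc a<b b<c
    with shatters (λ x → ¬? (x ≟ b))
  ... | window o L _ _ , cut
    with Equivalence.from (cut _ a∈) (<⇒≢ a<b) | Equivalence.from (cut _ c∈) (>⇒≢ b<c)
       | parity (o + a) in ea
  ... | _ , ha | _ , hc | 1ℙ =
    <-irrefl (odd-positions-coincide {o} {a} {c} ha hc ea (parity-+ˡ-≡ o (trans pa (sym pc)) ea))
             (<-trans a<b b<c)
  ... | _ , ha | c<L , hc | 0ℙ = Equivalence.to (cut b b∈) (<-trans b<c c<L , hb) refl
    where
    hb : IsOne (F k) (o + b)
    hb = F-even-between k ha hc (+-monoʳ-≤ o (<⇒≤ a<b)) (+-monoʳ-≤ o (<⇒≤ b<c))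
                          (parity-+ˡ-≡ o (trans pa (sym pb)) ea)

  no-sameParity-triple : ∀ {lo hi B a b c p} → WindowsShatter lo hi B →
    a ∈ B → b ∈ B → c ∈ B → a ≢ b → a ≢ c → b ≢ c →
    parity a ≡ p → parity b ≡ p → parity c ≡ p → ⊥
  no-sameParity-triple shatters a∈ b∈ c∈ a≢b a≢c b≢c pa pb pc with some-between a≢b a≢c b≢c
  ... | inj₁ (inj₁ (b<a , a<c))        = no-sameParity-between shatters b∈ a∈ c∈ pb pa pc b<a a<c
  ... | inj₁ (inj₂ (c<a , a<b))        = no-sameParity-between shatters c∈ a∈ b∈ pc pa pb c<a a<b
  ... | inj₂ (inj₁ (inj₁ (a<b , b<c))) = no-sameParity-between shatters a∈ b∈ c∈ pa pb pc a<b b<c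
  ... | inj₂ (inj₁ (inj₂ (c<b , b<a))) = no-sameParity-between shatters c∈ b∈ a∈ pc pb pa c<b b<a
  ... | inj₂ (inj₂ (inj₁ (a<c , c<b))) = no-sameParity-between shatters a∈ c∈ b∈ pa pc pb a<c c<b
  ... | inj₂ (inj₂ (inj₂ (b<c , c<a))) = no-sameParity-between shatters b∈ c∈ a∈ pb pc pa b<c c<a

  no-four-shattered : ∀ {lo hi a b c d rest} → Unique (a ∷ b ∷ c ∷ d ∷ rest) →
                      WindowsShatter lo hi (a ∷ b ∷ c ∷ d ∷ rest) → ⊥
  no-four-shattered {a = a} {b} {c} {d} {rest}
    ((a≢b ∷ a≢c ∷ a≢d ∷ _) ∷ (b≢c ∷ b≢d ∷ _) ∷ (c≢d ∷ _) ∷ _) shatters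
    with allInWindow shatters
  ... | window o _ _ _ , inW = by-position-parities
    where
    B : List ℕ
    B = a ∷ b ∷ c ∷ d ∷ rest

    even-triple : ∀ {x y z q} → x ∈ B → y ∈ B → z ∈ B → x ≢ y → x ≢ z → y ≢ z →
                  parity (o + x) ≡ q → parity (o + y) ≡ q → parity (o + z) ≡ q → ⊥
    even-triple x∈ y∈ z∈ x≢y x≢z y≢z ex ey ez =
      no-sameParity-triple shatters x∈ y∈ z∈ x≢y x≢z y≢z refl
        (parity-+ˡ-cancel o (trans ey (sym ex))) (parity-+ˡ-cancel o (trans ez (sym ex)))

    odd-pair : ∀ {x y} → x ∈ B → y ∈ B → x ≢ y →
               parity (o + x) ≡ 1ℙ → parity (o + y) ≡ 1ℙ → ⊥
    odd-pair {x} {y} x∈ y∈ x≢y ox oy =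
      x≢y (odd-positions-coincide {o} {x} {y} (proj₂ (inW _ x∈)) (proj₂ (inW _ y∈)) ox oy)

    by-position-parities : ⊥
    by-position-parities
      with parity (o + a) in ea | parity (o + b) in eb | parity (o + c) in ec | parity (o + d) in ed
    ... | 0ℙ | 0ℙ | 0ℙ | _  = even-triple first second third a≢b a≢c b≢c ea eb ec
    ... | 0ℙ | 0ℙ | _  | 0ℙ = even-triple first second fourth a≢b a≢d b≢d ea eb ed
    ... | 0ℙ | _  | 0ℙ | 0ℙ = even-triple first third fourth a≢c a≢d c≢d ea ec ed
    ... | _  | 0ℙ | 0ℙ | 0ℙ = even-triple second third fourth b≢c b≢d c≢d eb ec ed
    ... | 1ℙ | 1ℙ | _  | _  = odd-pair first second a≢b ea eb
    ... | 1ℙ | _  | 1ℙ | _  = odd-pair first third a≢c ea ec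
    ... | 1ℙ | _  | _  | 1ℙ = odd-pair first fourth a≢d ea ed
    ... | _  | 1ℙ | 1ℙ | _  = odd-pair second third b≢c eb ec
    ... | _  | 1ℙ | _  | 1ℙ = odd-pair second fourth b≢d eb ed
    ... | _  | _  | 1ℙ | 1ℙ = odd-pair third fourth c≢d ec ed

  no-other-parity-above : ∀ {lo hi B x y z o} → WindowsShatter lo hi B → x ∈ B → y ∈ B → z ∈ B →
    parity x ≢ parity z → x < y → y < z → IsOne (F k) (o + y) → o + z ≡ m → ⊥
  no-other-parity-above {x = x} {y} {z} {o} shatters x∈ y∈ z∈ px≢pz x<y y<z hy o+z≡m
    with shatters (λ w → ¬? (w ≟ y))
  ... | window o′ L′ _ _ , cut
    with Equivalence.from (cut _ x∈) (<⇒≢ x<y) | Equivalence.from (cut _ z∈) (>⇒≢ y<z)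
       | parity (o′ + z) in ez
  ... | _ , hx | z<L′ , hz | 1ℙ =
    Equivalence.to (cut y y∈) (<-trans y<z z<L′ , subst (λ s → IsOne (F k) (s + y)) (sym o′≡o) hy) refl
    where
    o′≡o : o′ ≡ o
    o′≡o = +-cancelʳ-≡ z o′ o (trans (F-odd-one k hz ez) (sym o+z≡m))
  ... | _ , hx | _ , hz | 0ℙ =
    no-two-above (+-monoʳ-< o′ x<y) (+-monoʳ-< o′ y<z)
      (subst (λ n → o′ + z ≤ suc n) (sym o′+x≡m) (F-one⇒≤ k hz))
    where
    o′+x≡m : o′ + x ≡ m
    o′+x≡m = F-odd-one k hx (parity-+ˡ-≢ o′ (≢-sym px≢pz) ez)

  no-mixed-triple-off-start : ∀ {lo hi B x y z} → WindowsShatter lo hi B → 1 ≤ lo →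
    x ∈ B → y ∈ B → z ∈ B → parity x ≡ parity y → parity y ≢ parity z →
    x < y → y ≡ suc z → ⊥
  no-mixed-triple-off-start {x = x} {y} {z} shatters 1≤lo x∈ y∈ z∈ px≡py py≢pz x<y y≡1+z
    with shatters (λ w → w ≟ y)
  ... | window o′ L′ lo≤o′ _ , cut with Equivalence.from (cut _ y∈) refl | parity (o′ + y) in ey
  ... | y<L′ , hy | 1ℙ = <⇒≢ z<y (Equivalence.to (cut z z∈) (<-trans z<y y<L′ , hz))
    where
    z<y : z < y
    z<y = subst (z <_) (sym y≡1+z) (n<1+n z)

    o′+z≡ : o′ + z ≡ 2 + length (tens k)
    o′+z≡ = suc-injective (begin
      suc (o′ + z)  ≡⟨ +-suc o′ z ⟨
      o′ + suc z    ≡⟨ cong (o′ +_) y≡1+z ⟨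
      o′ + y        ≡⟨ F-odd-one k hy ey ⟩
      m             ∎)
      where open ≡-Reasoning

    hz : IsOne (F k) (o′ + z)
    hz = F-even-one k (parity-+ˡ-≢ o′ py≢pz ey) (subst (2 ≤_) (sym o′+z≡) (m≤m+n 2 _))
                      (subst (_≤ suc m) (sym o′+z≡) (≤-trans (n≤1+n _) (n≤1+n _)))
  ... | y<L′ , hy | 0ℙ = <⇒≢ x<y (Equivalence.to (cut x x∈) (<-trans x<y y<L′ , hx))
    where
    ex : parity (o′ + x) ≡ 0ℙ
    ex = parity-+ˡ-≡ o′ (sym px≡py) ey

    hx : IsOne (F k) (o′ + x)
    hx = F-even-one k ex (even⇒2≤ ex (≤-trans 1≤lo (≤-trans lo≤o′ (m≤m+n o′ x))))
                         (≤-trans (<⇒≤ (+-monoʳ-< o′ x<y)) (F-one⇒≤ k hy))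

  no-mixed-triple-< : ∀ {lo hi B x y z} → WindowsShatter lo hi B → 1 ≤ lo ⊎ hi ≤ suc m →
    x ∈ B → y ∈ B → z ∈ B → parity x ≡ parity y → parity x ≢ parity z → x < y → ⊥
  no-mixed-triple-< {lo} {hi} {x = x} {y} {z} shatters proper x∈ y∈ z∈ px≡py px≢pz x<y
    with allInWindow shatters
  ... | window o L _ end≤hi , inW with inW x x∈ | inW y y∈ | inW z z∈ | parity (o + x) in ex
  ... | _ , hx | _ , hy | _ , _ | 1ℙ =
    <⇒≢ x<y (odd-positions-coincide {o} {x} {y} hx hy ex (parity-+ˡ-≡ o px≡py ex))
  ... | _ , hx | y<L , hy | _ , hz | 0ℙ = placed (F-odd-one k hz (parity-+ˡ-≢ o px≢pz ex))
    where
    o+y≤1+m : o + y ≤ suc m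
    o+y≤1+m = F-one⇒≤ k hy

    between : o + z ≡ m → z < y → ⊥
    between o+z≡m z<y = [ off-start , short ]′ proper
      where
      o+y≡ : o + y ≡ suc (o + z)
      o+y≡ = ≤-antisym (subst (λ n → o + y ≤ suc n) (sym o+z≡m) o+y≤1+m) (+-monoʳ-< o z<y)

      off-start : 1 ≤ lo → ⊥
      off-start 1≤lo = no-mixed-triple-off-start shatters 1≤lo x∈ y∈ z∈ px≡py
        (λ e → px≢pz (trans px≡py e)) x<y (+-cancelˡ-≡ o y (suc z) (trans o+y≡ (sym (+-suc o z))))

      short : hi ≤ suc m → ⊥
      short hi≤1+m =
        <⇒≱ (+-monoʳ-< o y<L) (≤-trans end≤hi (≤-trans hi≤1+m (≤-reflexive (sym o+y≡1+m))))
        where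
        o+y≡1+m : o + y ≡ suc m
        o+y≡1+m = trans o+y≡ (cong suc o+z≡m)

    placed : o + z ≡ m → ⊥
    placed o+z≡m with <-cmp z x | <-cmp z y
    ... | tri≈ _ z≡x _ | _            = px≢pz (cong parity (sym z≡x))
    ... | _            | tri≈ _ z≡y _ = px≢pz (trans px≡py (cong parity (sym z≡y)))
    ... | tri< z<x _ _ | _            =
      no-two-above (+-monoʳ-< o z<x) (+-monoʳ-< o x<y) (subst (λ n → o + y ≤ suc n) (sym o+z≡m) o+y≤1+m)
    ... | _            | tri> _ _ y<z = no-other-parity-above shatters x∈ y∈ z∈ px≢pz x<y y<z hy o+z≡m
    ... | tri> _ _ _   | tri< z<y _ _ = between o+z≡m z<y

  no-mixed-triple : ∀ {lo hi B x y z} → WindowsShatter lo hi B → 1 ≤ lo ⊎ hi ≤ suc m →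
    x ∈ B → y ∈ B → z ∈ B → x ≢ y → parity x ≡ parity y → parity x ≢ parity z → ⊥
  no-mixed-triple {x = x} {y} shatters proper x∈ y∈ z∈ x≢y px≡py px≢pz with <-cmp x y
  ... | tri< x<y _ _ = no-mixed-triple-< shatters proper x∈ y∈ z∈ px≡py px≢pz x<y
  ... | tri≈ _ x≡y _ = x≢y x≡y
  ... | tri> _ _ y<x = no-mixed-triple-< shatters proper y∈ x∈ z∈ (sym px≡py)
                         (λ e → px≢pz (trans px≡py e)) y<x

  no-three-shattered-properly : ∀ {lo hi a b c rest} → Unique (a ∷ b ∷ c ∷ rest) →
    WindowsShatter lo hi (a ∷ b ∷ c ∷ rest) → 1 ≤ lo ⊎ hi ≤ suc m → ⊥
  no-three-shattered-properly {a = a} {b} {c} ((a≢b ∷ a≢c ∷ _) ∷ (b≢c ∷ _) ∷ _) shatters proper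
    with parity a ≟ℙ parity b | parity a ≟ℙ parity c
  ... | yes pa≡pb | yes pa≡pc =
    no-sameParity-triple shatters first second third a≢b a≢c b≢c refl (sym pa≡pb) (sym pa≡pc)
  ... | yes pa≡pb | no pa≢pc =
    no-mixed-triple shatters proper first second third a≢b pa≡pb pa≢pc
  ... | no pa≢pb  | yes pa≡pc =
    no-mixed-triple shatters proper first third second a≢c pa≡pc pa≢pb
  ... | no pa≢pb  | no pa≢pc =
    no-mixed-triple shatters proper second third first b≢c
      (trans (≢⇒≡⁻¹ pa≢pb) (sym (≢⇒≡⁻¹ pa≢pc))) (≢-sym pa≢pb)

F-shatters-at-most-3 : ∀ k B → Shattered (F k) B → length B ≤ 3
F-shatters-at-most-3 k []                  _ = z≤n
F-shatters-at-most-3 k (_ ∷ [])            _ = s≤s z≤n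
F-shatters-at-most-3 k (_ ∷ _ ∷ [])        _ = s≤s (s≤s z≤n)
F-shatters-at-most-3 k (_ ∷ _ ∷ _ ∷ [])    _ = s≤s (s≤s (s≤s z≤n))
F-shatters-at-most-3 k (_ ∷ _ ∷ _ ∷ _ ∷ _) shattered@(unique , _) =
  ⊥-elim (no-four-shattered k unique
    (Shattered⇒WindowsShatter {u = []} {v = []} (sym (++-identityʳ (F k))) shattered))
  where open Windows (F k)

proper-infix-avoids-an-end : ∀ k (u : BinStr) {S' : BinStr} → length S' < length (F k) →
                             1 ≤ length u ⊎ length u + length S' ≤ suc (oddOne k)
proper-infix-avoids-an-end k [] {S'} shorter = inj₂ (≤-pred (subst (length S' <_) (length-F k) shorter))
proper-infix-avoids-an-end k (_ ∷ _) _ = inj₁ (s≤s z≤n)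

proper-infix-shatters-at-most-2 : ∀ k {S'} B → Substring S' (F k) → length S' < length (F k) →
                                  Shattered S' B → length B < 3
proper-infix-shatters-at-most-2 k []           _ _ _ = s≤s z≤n
proper-infix-shatters-at-most-2 k (_ ∷ [])     _ _ _ = s≤s (s≤s z≤n)
proper-infix-shatters-at-most-2 k (_ ∷ _ ∷ []) _ _ _ = s≤s (s≤s (s≤s z≤n))
proper-infix-shatters-at-most-2 k {S'} (_ ∷ _ ∷ _ ∷ _) (u , v , F≡) shorter shattered@(unique , _) =
  ⊥-elim (no-three-shattered-properly k unique (Shattered⇒WindowsShatter {u} {S'} {v} F≡ shattered)
                                             (proper-infix-avoids-an-end k u {S'} shorter))
  where open Windows (F k)

isOne? : ∀ s i → Dec (IsOne s i)
isOne? []          _       = no λ ()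
isOne? (true ∷ _)  zero    = yes tt
isOne? (false ∷ _) zero    = no λ ()
isOne? (true ∷ s)  (suc i) = isOne? s i
isOne? (false ∷ s) (suc i) = isOne? s i

does-≡⇒⇔ : ∀ {A B : Set} (a? : Dec A) (b? : Dec B) → does a? ≡ does b? → A ⇔ B
does-≡⇒⇔ (yes a)  (yes b)  _ = mk⇔ (λ _ → b) (λ _ → a)
does-≡⇒⇔ (no ¬a) (no ¬b) _ = mk⇔ (⊥-elim ∘ ¬a) (⊥-elim ∘ ¬b)

trace-by-decision : ∀ {s T B} → All (λ b → does (isOne? s b) ≡ does (b ∈? T)) B →
                    ∀ b → b ∈ B → IsOne s b ⇔ b ∈ T
trace-by-decision {s} {T} agree b b∈B = does-≡⇒⇔ (isOne? s b) (b ∈? T) (lookup agree b∈B)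

tens-suc-++ : ∀ k xs → tens (suc k) ++ xs ≡ tens k ++ true ∷ false ∷ xs
tens-suc-++ zero    xs = refl
tens-suc-++ (suc k) xs = cong (λ w → true ∷ false ∷ w) (tens-suc-++ k xs)

infix-of-F-end : ∀ k u s v → u ++ s ++ v ≡ true ∷ false ∷ true ∷ true ∷ true ∷ [] →
                 Substring s (F (suc k))
infix-of-F-end k u s v end≡ = false ∷ false ∷ tens k ++ u , v , (begin
  false ∷ false ∷ tens (suc k) ++ true ∷ true ∷ true ∷ []
    ≡⟨ cong (λ w → false ∷ false ∷ w) (tens-suc-++ k _) ⟩
  false ∷ false ∷ tens k ++ true ∷ false ∷ true ∷ true ∷ true ∷ []
    ≡⟨ cong (λ w → false ∷ false ∷ tens k ++ w) end≡ ⟨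
  false ∷ false ∷ tens k ++ u ++ s ++ v
    ≡⟨ cong (λ w → false ∷ false ∷ w) (++-assoc (tens k) u (s ++ v)) ⟨
  (false ∷ false ∷ tens k ++ u) ++ s ++ v ∎)
  where open ≡-Reasoning

F-shatters-012 : ∀ k → Shattered (F (suc k)) (0 ∷ 1 ∷ 2 ∷ [])
F-shatters-012 k = ((λ ()) ∷ (λ ()) ∷ []) ∷ ((λ ()) ∷ []) ∷ [] ∷ [] , realise
  where
  realised-by : ∀ {T} s → Substring s (F (suc k)) →
                All (λ b → does (isOne? s b) ≡ does (b ∈? T)) (0 ∷ 1 ∷ 2 ∷ []) →
                Σ BinStr λ s → Substring s (F (suc k)) ×
                               (∀ b → b ∈ 0 ∷ 1 ∷ 2 ∷ [] → IsOne s b ⇔ b ∈ T)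
  realised-by s occurs agree = s , occurs , trace-by-decision {s} agree

  realise : ∀ T → T ⊆ 0 ∷ 1 ∷ 2 ∷ [] → Σ BinStr λ s → Substring s (F (suc k)) ×
            (∀ b → b ∈ 0 ∷ 1 ∷ 2 ∷ [] → IsOne s b ⇔ b ∈ T)
  realise _ (0 ∷ʳ 1 ∷ʳ 2 ∷ʳ []) =
    realised-by [] ([] , _ , refl)
      (refl ∷ refl ∷ refl ∷ [])
  realise _ (refl ∷ 1 ∷ʳ 2 ∷ʳ []) =
    realised-by (true ∷ []) (false ∷ false ∷ [] , _ , refl)
      (refl ∷ refl ∷ refl ∷ [])
  realise _ (0 ∷ʳ refl ∷ 2 ∷ʳ []) =
    realised-by (false ∷ true ∷ []) (false ∷ [] , _ , refl)
      (refl ∷ refl ∷ refl ∷ [])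
  realise _ (0 ∷ʳ 1 ∷ʳ refl ∷ []) =
    realised-by (false ∷ false ∷ true ∷ []) ([] , _ , refl)
      (refl ∷ refl ∷ refl ∷ [])
  realise _ (refl ∷ refl ∷ 2 ∷ʳ []) =
    realised-by (true ∷ true ∷ []) (infix-of-F-end k (true ∷ false ∷ true ∷ []) _ _ refl)
      (refl ∷ refl ∷ refl ∷ [])
  realise _ (refl ∷ 1 ∷ʳ refl ∷ []) =
    realised-by (true ∷ false ∷ true ∷ []) (infix-of-F-end k [] _ _ refl)
      (refl ∷ refl ∷ refl ∷ [])
  realise _ (0 ∷ʳ refl ∷ refl ∷ []) =
    realised-by (false ∷ true ∷ true ∷ []) (infix-of-F-end k (true ∷ []) _ _ refl)
      (refl ∷ refl ∷ refl ∷ [])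
  realise _ (refl ∷ refl ∷ refl ∷ []) =
    realised-by (true ∷ true ∷ true ∷ []) (infix-of-F-end k (true ∷ false ∷ []) _ _ refl)
      (refl ∷ refl ∷ refl ∷ [])

proposition19 : ∀ (k : ℕ) → 1 ≤ k → Prime 3 (F k)
proposition19 zero    ()
proposition19 (suc k) _ =
  ((0 ∷ 1 ∷ 2 ∷ [] , F-shatters-012 k , refl) , F-shatters-at-most-3 (suc k)) , proper-infixes
  where
  proper-infixes : ∀ S' → Substring S' (F (suc k)) → length S' < length (F (suc k)) →
                   ∀ d → VCdim S' d → d < 3
  proper-infixes S' S'-infix shorter _ ((B , shattered , refl) , _) =
    proper-infix-shatters-at-most-2 (suc k) B S'-infix shorter shattered
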